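{- Let $G^c$ be a connected $c$-edge-coloured multigraph, $c\geq 2$. Suppose that $G^c$ contains a proper path $P=x_1y_1x_2y_2\ldots x_py_p$, $p\geq 3$, such that each edge $x_iy_i$ is red. If $G^c$ does not contain a proper cycle $C$ with $V(C)=V(P)$, then there are at least $(c-1)(2p-2)$ missing edges in $G^c$.
   Context: A $c$-edge-coloured multigraph $G^c$ is a multigraph in which every edge receives one colour from $\{1,\ldots,c\}$ (one of which is called red) and no two parallel edges joining the same pair of vertices have the same colour. A path or cycle is proper if any two consecutive (adjacent) edges of it have different colours. A missing edge of $G^c$ is a pair (unordered pair of distinct vertices $v,w$, colour $i\in\{1,\ldots,c\}$) such that $G^c$ has no edge $vw$ of colour $i$, i.e. an edge of the complement multigraph $\overline{G^c}$. -}

module Defs where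

open import Data.Nat using (ℕ; zero; suc; _+_; _*_; _<_; _<ᵇ_)
open import Data.Nat.DivMod using (_%_)
open import Data.Fin using (Fin; toℕ)
open import Data.Bool using (Bool; true; false; not; _∧_; if_then_else_)
open import Data.Product using (Σ; ∃; _×_)
open import Relation.Binary.PropositionalEquality using (_≡_; _≢_)
open import Relation.Nullary using (¬_)
open import Function.Bundles using (_⇔_)

-- A c-edge-coloured multigraph on vertex set Fin n.
-- edge v w i = true  iff  there is an edge vw of colour i.
-- Since parallel edges joining the same pair have distinct colours,
-- the multigraph is determined by this (symmetric, loopless) relation.
record MG (n c : ℕ) : Set where
  field
    edge     : Fin n → Fin n → Fin c → Bool
    sym      : ∀ v w i → edge v w i ≡ edge w v i
    loopless : ∀ v i → edge v v i ≡ false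
open MG public

data Reach {n c : ℕ} (G : MG n c) : Fin n → Fin n → Set where
  here : ∀ {v} → Reach G v v
  step : ∀ {u v w} (i : Fin c) → edge G u v i ≡ true → Reach G v w → Reach G u w

Connected : ∀ {n c} → MG n c → Set
Connected G = ∀ u v → Reach G u v

record ProperPath {n c : ℕ} (G : MG n c) (L : ℕ) : Set where
  field
    vert   : ℕ → Fin n
    col    : ℕ → Fin c
    inj    : ∀ i j → i < L → j < L → vert i ≡ vert j → i ≡ j
    edges  : ∀ k → suc k < L → edge G (vert k) (vert (suc k)) (col k) ≡ true
    proper : ∀ k → suc (suc k) < L → col k ≢ col (suc k)
open ProperPath public

-- A proper cycle of length L = 2 + l (vertices vert 0 .. vert (L-1);
-- edge k joins vert k and vert ((k+1) mod L), colour col k).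
record ProperCycle {n c : ℕ} (G : MG n c) (l : ℕ) : Set where
  field
    cvert   : ℕ → Fin n
    ccol    : ℕ → Fin c
    cinj    : ∀ i j → i < suc (suc l) → j < suc (suc l) → cvert i ≡ cvert j → i ≡ j
    cedges  : ∀ k → k < suc (suc l) →
              edge G (cvert k) (cvert (suc k % suc (suc l))) (ccol k) ≡ true
    cproper : ∀ k → k < suc (suc l) → ccol k ≢ ccol (suc k % suc (suc l))
open ProperCycle public

SameVertexSet : ∀ {n c} {G : MG n c} {l L : ℕ} → ProperCycle G l → ProperPath G L → Set
SameVertexSet {n} {l = l} {L} C P =
  ∀ (x : Fin n) → (∃ λ k → k < suc (suc l) × cvert C k ≡ x) ⇔ (∃ λ j → j < L × vert P j ≡ x)

sumFin : ∀ {m} → (Fin m → ℕ) → ℕ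
sumFin {zero}  f = 0
sumFin {suc m} f = f Fin.zero + sumFin (λ i → f (Fin.suc i))

-- number of missing edges: pairs {v,w} (v ≠ w, counted once via toℕ v < toℕ w)
-- together with a colour i such that there is no edge vw of colour i
missing : ∀ {n c} → MG n c → ℕ
missing G = sumFin λ v → sumFin λ w → sumFin λ i →
  if (toℕ v <ᵇ toℕ w) ∧ not (edge G v w i) then 1 else 0

-- Write P = x_0 y_0 … x_q y_q (so p = q + 1). A proper cycle that traverses every red edge
-- x_m y_m and joins consecutive red edges by non-red edges has vertex set V(P). Fix a non-red
-- colour a. Each of the 2q pairwise disjoint "gadgets"
--   {y_q x_0},  {y_j y_q, x_0 x_{j+1}} (j < q),  {y_h x_{h+2}, y_q x_{h+1}, y_{h+1} x_0} (h + 2 ≤ q)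
-- would, if all its pairs were edges of colour a, complete such a cycle together with the edges
-- of P: close P up, reverse its tail after y_j, or move x_{h+1} y_{h+1} to the end. So every
-- gadget contains a missing edge of colour a, and these (c − 1) · 2q missing edges are distinct.

module Submission where

open import Defs hiding (sym)
open import Data.Bool using (Bool; T; true; false; not; _∧_; _xor_; if_then_else_)
open import Data.Bool.Properties using (xor-assoc; xor-same; xor-identityʳ)
open import Data.Empty using (⊥-elim)
open import Data.Fin using (Fin; zero; suc; toℕ; _↑ˡ_; _↑ʳ_; combine; remQuot; punchIn; punchOut)
open import Data.Fin.Properties
  using (remQuot-combine; combine-remQuot; punchIn-punchOut; punchOut-injective; punchIn-injective; punchInᵢ≢i; suc-injective; toℕ-injective; toℕ<n)
open import Data.Nat using (ℕ; zero; suc; _+_; _*_; _∸_; _≤_; _<_; _<ᵇ_; _%_; z≤n; s≤s; pred)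
open import Data.Nat.DivMod using (m<n⇒m%n≡m; n%n≡0)
open import Data.Nat.Properties
  using (+-0-commutativeMonoid; +-assoc; +-cancelʳ-≤; +-identityʳ; +-mono-≤; +-suc; <-cmp; <-irrefl; <-trans;
         <-≤-trans; <⇒<ᵇ; <⇒≤; _<?_; _≟_; _≤?_; m+[n∸m]≡n; m+n∸m≡n; m+n∸n≡m; m<n⇒m<1+n; m∸[m∸n]≡n;
         m∸n+n≡m; m≤m+n; m≤n+m; m≤n⇒m<n∨m≡n; n<1+n; n≤1+n; pred[n]≤n; ∸-monoʳ-≤; ≤-antisym; ≤-refl;
         ≤-reflexive; ≤-trans; ≤∧≢⇒<; ≮⇒≥; ≰⇒>)
open import Algebra.Properties.CommutativeMonoid.Sum +-0-commutativeMonoid using (sum; sum-remove)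
open import Data.Product using (_×_; _,_; proj₁; proj₂; ∃; map₁; map₂; uncurry)
open import Data.Sum using (_⊎_; inj₁; inj₂)
open import Data.Unit using (⊤; tt)
open import Data.Vec.Functional using (removeAt)
open import Function.Base using (_∘_)
open import Function.Bundles using (mk⇔)
open import Function.Definitions using (Injective)
open import Relation.Binary.Definitions using (tri<; tri≈; tri>)
open import Relation.Binary.PropositionalEquality
open import Relation.Nullary using (¬_; yes; no; contradiction)

<⇒<ᵇ≡true : ∀ {m n} → m < n → (m <ᵇ n) ≡ true
<⇒<ᵇ≡true {zero}  (s≤s _)          = refl
<⇒<ᵇ≡true {suc m} (s≤s m<n@(s≤s _)) = <⇒<ᵇ≡true m<n

≤⇒<ᵇ≡false : ∀ {m n} → n ≤ m → (m <ᵇ n) ≡ false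
≤⇒<ᵇ≡false z≤n       = refl
≤⇒<ᵇ≡false (s≤s n≤m) = ≤⇒<ᵇ≡false n≤m

<ᵇ≡false⇒≤ : ∀ {m n} → (m <ᵇ n) ≡ false → n ≤ m
<ᵇ≡false⇒≤ m≮n = ≮⇒≥ (λ m<n → subst T m≮n (<⇒<ᵇ m<n))

-- Counting missing edges

sumFin≡sum : ∀ {m} (f : Fin m → ℕ) → sumFin f ≡ sum f
sumFin≡sum {zero}  f = refl
sumFin≡sum {suc m} f = cong (f zero +_) (sumFin≡sum (f ∘ suc))

sumFin-cong : ∀ {m} {f g : Fin m → ℕ} → (∀ i → f i ≡ g i) → sumFin f ≡ sumFin g
sumFin-cong {zero}  f≗g = refl
sumFin-cong {suc m} f≗g = cong₂ _+_ (f≗g zero) (sumFin-cong (f≗g ∘ suc))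

sumFin-removeAt : ∀ {m} (f : Fin (suc m) → ℕ) i → sumFin f ≡ f i + sumFin (removeAt f i)
sumFin-removeAt f i = begin
  sumFin f                      ≡⟨ sumFin≡sum f ⟩
  sum f                         ≡⟨ sum-remove f ⟩
  f i + sum (removeAt f i)      ≡⟨ cong (f i +_) (sumFin≡sum (removeAt f i)) ⟨
  f i + sumFin (removeAt f i)   ∎
  where open ≡-Reasoning

sumFin-↑ : ∀ k {l} (f : Fin (k + l) → ℕ) →
           sumFin f ≡ sumFin (f ∘ (_↑ˡ l)) + sumFin (f ∘ (k ↑ʳ_))
sumFin-↑ zero    f = refl
sumFin-↑ (suc k) f = trans (cong (f zero +_) (sumFin-↑ k (f ∘ suc)))
                           (sym (+-assoc (f zero) _ _))

sumFin-combine : ∀ m k (f : Fin (m * k) → ℕ) →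
                 sumFin f ≡ sumFin (λ i → sumFin (λ j → f (combine {m} {k} i j)))
sumFin-combine zero    k f = refl
sumFin-combine (suc m) k f =
  trans (sumFin-↑ k f) (cong (sumFin (f ∘ (_↑ˡ m * k)) +_) (sumFin-combine m k (f ∘ (k ↑ʳ_))))

injective-count : ∀ {N m} (f : Fin m → ℕ) (g : Fin N → Fin m) → Injective _≡_ _≡_ g →
                  (∀ k → 1 ≤ f (g k)) → N ≤ sumFin f
injective-count {zero}          f g g-inj pos = z≤n
injective-count {suc N} {zero}  f g g-inj pos with g zero
... | ()
injective-count {suc N} {suc m} f g g-inj pos =
  subst (suc N ≤_) (sym (sumFin-removeAt f (g zero)))
    (+-mono-≤ (pos zero) (injective-count (removeAt f (g zero)) g′ g′-inj pos′))
  where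
  g0≢ : ∀ k → g zero ≢ g (suc k)
  g0≢ k eq with g-inj eq
  ... | ()
  g′ : Fin N → Fin m
  g′ k = punchOut (g0≢ k)
  g′-inj : Injective _≡_ _≡_ g′
  g′-inj eq = suc-injective (g-inj (punchOut-injective (g0≢ _) (g0≢ _) eq))
  pos′ : ∀ k → 1 ≤ removeAt f (g zero) (g′ k)
  pos′ k rewrite punchIn-punchOut (g0≢ k) = pos (suc k)

SameEdge : ∀ {n c} → Fin n × Fin n × Fin c → Fin n × Fin n × Fin c → Set
SameEdge (u , v , a) (u′ , v′ , a′) = a ≡ a′ × ((u ≡ u′ × v ≡ v′) ⊎ (u ≡ v′ × v ≡ u′))

module _ {n c} (G : MG n c) where

  isMissing : Fin n × Fin n × Fin c → ℕ
  isMissing (v , w , i) = if (toℕ v <ᵇ toℕ w) ∧ not (edge G v w i) then 1 else 0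

  orient : Fin n × Fin n × Fin c → Fin n × Fin n × Fin c
  orient (u , v , a) = if toℕ u <ᵇ toℕ v then (u , v , a) else (v , u , a)

  orient-isMissing : ∀ {u v a} → u ≢ v → edge G u v a ≡ false → isMissing (orient (u , v , a)) ≡ 1
  orient-isMissing {u} {v} {a} u≢v uv∉G with toℕ u <ᵇ toℕ v in u<v
  ... | true rewrite u<v | uv∉G = refl
  ... | false with toℕ v <ᵇ toℕ u in v<u
  ...   | true rewrite MG.sym G v u a | uv∉G = refl
  ...   | false = contradiction (toℕ-injective (≤-antisym (<ᵇ≡false⇒≤ v<u) (<ᵇ≡false⇒≤ u<v))) u≢v

  orient-sameEdge : ∀ e e′ → orient e ≡ orient e′ → SameEdge e e′
  orient-sameEdge (u , v , a) (u′ , v′ , a′) eq with toℕ u <ᵇ toℕ v | toℕ u′ <ᵇ toℕ v′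
  orient-sameEdge _ _ refl | true  | true  = refl , inj₁ (refl , refl)
  orient-sameEdge _ _ refl | true  | false = refl , inj₂ (refl , refl)
  orient-sameEdge _ _ refl | false | true  = refl , inj₂ (refl , refl)
  orient-sameEdge _ _ refl | false | false = refl , inj₁ (refl , refl)

  encode : Fin n × Fin n × Fin c → Fin (n * (n * c))
  encode (v , w , i) = combine v (combine w i)

  decode : Fin (n * (n * c)) → Fin n × Fin n × Fin c
  decode = map₂ (remQuot c) ∘ remQuot (n * c)

  decode-encode : ∀ e → decode (encode e) ≡ e
  decode-encode (v , w , i) =
    trans (cong (map₂ (remQuot c)) (remQuot-combine v (combine w i))) (cong (v ,_) (remQuot-combine w i))

  missing≡sumFin : missing G ≡ sumFin (isMissing ∘ decode)
  missing≡sumFin = sym (begin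
    sumFin (isMissing ∘ decode)
      ≡⟨ sumFin-combine n (n * c) (isMissing ∘ decode) ⟩
    sumFin (λ v → sumFin (λ y → isMissing (decode (combine {n} v y))))
      ≡⟨ sumFin-cong (λ v → sumFin-combine n c (λ y → isMissing (decode (combine {n} v y)))) ⟩
    sumFin (λ v → sumFin (λ w → sumFin (λ i → isMissing (decode (encode (v , w , i))))))
      ≡⟨ sumFin-cong (λ v → sumFin-cong (λ w → sumFin-cong (λ i → cong isMissing (decode-encode (v , w , i))))) ⟩
    missing G ∎)
    where open ≡-Reasoning

  missing-lower-bound : ∀ {N} (e : Fin N → Fin n × Fin n × Fin c) →
    (∀ k → let (u , v , a) = e k in u ≢ v × edge G u v a ≡ false) →
    (∀ k l → SameEdge (e k) (e l) → k ≡ l) → N ≤ missing G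
  missing-lower-bound e e-missing e-distinct =
    subst (_ ≤_) (sym missing≡sumFin) (injective-count (isMissing ∘ decode) (encode ∘ orient ∘ e) injective positive)
    where
    injective : Injective _≡_ _≡_ (encode ∘ orient ∘ e)
    injective {k} {l} eq = e-distinct k l (orient-sameEdge (e k) (e l)
      (trans (sym (decode-encode _)) (trans (cong decode eq) (decode-encode _))))
    positive : ∀ k → 1 ≤ isMissing (decode (encode (orient (e k))))
    positive k with e k | e-missing k
    ... | u , v , a | u≢v , uv∉G = subst (λ t → 1 ≤ isMissing t) (sym (decode-encode (orient (u , v , a))))
                                     (≤-reflexive (sym (orient-isMissing u≢v uv∉G)))


-- Positions on the path

double : ℕ → ℕ
double zero    = zero
double (suc m) = suc (suc (double m))

double≡m+m : ∀ m → double m ≡ m + m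
double≡m+m zero    = refl
double≡m+m (suc m) = cong suc (trans (cong suc (double≡m+m m)) (sym (+-suc m m)))

double≡2* : ∀ m → double m ≡ 2 * m
double≡2* m = trans (double≡m+m m) (cong (m +_) (sym (+-identityʳ m)))

-- (m , false) and (m , true) stand for the vertices x_m = vert 2m and y_m = vert (2m+1) of the path.
Slot : Set
Slot = ℕ × Bool

index : Slot → ℕ
index (m , false) = double m
index (m , true)  = suc (double m)

slot : ℕ → Slot
slot zero          = 0 , false
slot (suc zero)    = 0 , true
slot (suc (suc k)) = map₁ suc (slot k)

index-slot : ∀ k → index (slot k) ≡ k
index-slot zero          = refl
index-slot (suc zero)    = refl
index-slot (suc (suc k)) with slot k | index-slot k
... | m , false | eq = cong (2 +_) eq
... | m , true  | eq = cong (2 +_) eq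

slot-index : ∀ s → slot (index s) ≡ s
slot-index (zero  , false) = refl
slot-index (zero  , true)  = refl
slot-index (suc m , false) = cong (map₁ suc) (slot-index (m , false))
slot-index (suc m , true)  = cong (map₁ suc) (slot-index (m , true))

index-injective : ∀ {s t} → index s ≡ index t → s ≡ t
index-injective {s} {t} eq = trans (sym (slot-index s)) (trans (cong slot eq) (slot-index t))

index-bound : ∀ {m q} b → m ≤ q → index (m , b) < double (suc q)
index-bound false z≤n      = s≤s z≤n
index-bound true  z≤n      = s≤s (s≤s z≤n)
index-bound false (s≤s m≤q) = s≤s (s≤s (index-bound false m≤q))
index-bound true  (s≤s m≤q) = s≤s (s≤s (index-bound true m≤q))

slot-bound : ∀ q k → k < double (suc q) → proj₁ (slot k) ≤ q
slot-bound q       zero          _                 = z≤n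
slot-bound q       (suc zero)    _                 = z≤n
slot-bound zero    (suc (suc k)) (s≤s (s≤s ()))
slot-bound (suc q) (suc (suc k)) (s≤s (s≤s k<))    = s≤s (slot-bound q k k<)

xor-involutiveʳ : ∀ a b → (b xor a) xor a ≡ b
xor-involutiveʳ a b = begin
  (b xor a) xor a   ≡⟨ xor-assoc b a a ⟩
  b xor (a xor a)   ≡⟨ cong (b xor_) (xor-same a) ⟩
  b xor false       ≡⟨ xor-identityʳ b ⟩
  b                 ∎
  where open ≡-Reasoning

xor-cancelʳ : ∀ a {b b′} → b xor a ≡ b′ xor a → b ≡ b′
xor-cancelʳ a {b} {b′} eq =
  trans (sym (xor-involutiveʳ a b)) (trans (cong (_xor a) eq) (xor-involutiveʳ a b′))

m<n⇒n∸m≡1+[n∸1+m] : ∀ {m n} → m < n → n ∸ m ≡ suc (n ∸ suc m)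
m<n⇒n∸m≡1+[n∸1+m] {zero}  (s≤s _)   = refl
m<n⇒n∸m≡1+[n∸1+m] {suc m} (s≤s m<n) = m<n⇒n∸m≡1+[n∸1+m] m<n

module AlternatingPath {n c : ℕ} (G : MG n c) (red : Fin c) (q : ℕ) (P : ProperPath G (2 * suc q))
                       (red-cols : ∀ i → i < suc q → col P (2 * i) ≡ red) where

  vtx : Slot → Fin n
  vtx s = vert P (index s)

  x y : ℕ → Fin n
  x m = vtx (m , false)
  y m = vtx (m , true)

  index<length : ∀ {m} b → m ≤ q → index (m , b) < 2 * suc q
  index<length {m} b m≤q = subst (index (m , b) <_) (double≡2* (suc q)) (index-bound b m≤q)

  vtx-injective : ∀ s t → proj₁ s ≤ q → proj₁ t ≤ q → vtx s ≡ vtx t → s ≡ t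
  vtx-injective (m , b) (m′ , b′) m≤q m′≤q eq =
    index-injective (inj P _ _ (index<length b m≤q) (index<length b′ m′≤q) eq)

  red-edge : ∀ {m} o → m ≤ q → edge G (vtx (m , o)) (vtx (m , not o)) red ≡ true
  red-edge {m} false m≤q =
    subst (λ a → edge G (x m) (y m) a ≡ true)
          (trans (cong (col P) (double≡2* m)) (red-cols m (s≤s m≤q)))
          (edges P (double m) (index<length true m≤q))
  red-edge {m} true m≤q = trans (MG.sym G (y m) (x m) red) (red-edge false m≤q)

  link : ℕ → Fin c
  link m = col P (suc (double m))

  link-edge : ∀ {m} → m < q → edge G (y m) (x (suc m)) (link m) ≡ true
  link-edge {m} m<q = edges P (suc (double m)) (index<length false m<q)

  link≢red : ∀ {m} → m < q → link m ≢ red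
  link≢red {m} m<q eq = proper P (double m) (index<length false m<q)
    (trans (trans (cong (col P) (double≡2* m)) (red-cols m (m<n⇒m<1+n m<q))) (sym eq))

  HamiltonianCycle : Set
  HamiltonianCycle = ∃ λ l → ∃ λ (C : ProperCycle G l) → SameVertexSet C P

  data NextSlot : Slot → Slot → Set where
    along-red  : ∀ {m} → NextSlot (m , false) (m , true)
    along-link : ∀ {m} → m < q → NextSlot (m , true) (suc m , false)
    wrap       : NextSlot (q , true) (0 , false)

  next-slot : ∀ m b → m ≤ q → NextSlot (m , b) (slot (suc (index (m , b)) % double (suc q)))
  next-slot m false m≤q
    rewrite m<n⇒m%n≡m (index-bound true m≤q) | slot-index (m , true) = along-red
  next-slot m true m≤q with m≤n⇒m<n∨m≡n m≤q
  ... | inj₁ m<q rewrite m<n⇒m%n≡m (index-bound false m<q) | slot-index (suc m , false) = along-link m<q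
  ... | inj₂ refl = subst (NextSlot (q , true) ∘ slot) (sym (n%n≡0 (double (suc q)))) wrap

  -- Hamiltonian cycles through all red edges

  -- A Hamiltonian cycle that uses every red edge x_m y_m: its m-th red edge is the path's
  -- red edge number `order m`, entered at y rather than x iff `flipped m`.
  record Arrangement : Set where
    field
      order order⁻¹   : ℕ → ℕ
      flipped         : ℕ → Bool
      joinColour      : ℕ → Fin c
      order-bound     : ∀ m → m ≤ q → order m ≤ q
      order⁻¹-bound   : ∀ m → m ≤ q → order⁻¹ m ≤ q
      order⁻¹-order   : ∀ m → m ≤ q → order⁻¹ (order m) ≡ m
      order-order⁻¹   : ∀ m → m ≤ q → order (order⁻¹ m) ≡ m
      joinColour≢red  : ∀ m → m ≤ q → joinColour m ≢ red
      join            : ∀ m → m < q →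
        edge G (vtx (order m , not (flipped m))) (vtx (order (suc m) , flipped (suc m))) (joinColour m) ≡ true
      close           :
        edge G (vtx (order q , not (flipped q))) (vtx (order 0 , flipped 0)) (joinColour q) ≡ true

  module _ (A : Arrangement) where
    open Arrangement A

    cycleVtx : Slot → Fin n
    cycleVtx (m , b) = vtx (order m , b xor flipped m)

    cycleCol : Slot → Fin c
    cycleCol (m , false) = red
    cycleCol (m , true)  = joinColour m

    cycle-edge : ∀ m b → m ≤ q →
      edge G (cycleVtx (m , b)) (cycleVtx (slot (suc (index (m , b)) % double (suc q)))) (cycleCol (m , b)) ≡ true
    cycle-edge m b m≤q with slot (suc (index (m , b)) % double (suc q)) | next-slot m b m≤q
    ... | _ | along-red      = red-edge (flipped m) (order-bound m m≤q)
    ... | _ | along-link m<q = join m m<q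
    ... | _ | wrap           = close

    cycle-proper : ∀ m b → m ≤ q → cycleCol (m , b) ≢ cycleCol (slot (suc (index (m , b)) % double (suc q)))
    cycle-proper m b m≤q with slot (suc (index (m , b)) % double (suc q)) | next-slot m b m≤q
    ... | _ | along-red    = joinColour≢red m m≤q ∘ sym
    ... | _ | along-link _ = joinColour≢red m m≤q
    ... | _ | wrap         = joinColour≢red m m≤q

    cycleVtx-injective : ∀ s t → proj₁ s ≤ q → proj₁ t ≤ q → cycleVtx s ≡ cycleVtx t → s ≡ t
    cycleVtx-injective (m , b) (m′ , b′) m≤q m′≤q eq
      with vtx-injective (order m , b xor flipped m) (order m′ , b′ xor flipped m′) (order-bound m m≤q) (order-bound m′ m′≤q) eq
    ... | eq′ with trans (sym (order⁻¹-order m m≤q)) (trans (cong (order⁻¹ ∘ proj₁) eq′) (order⁻¹-order m′ m′≤q))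
    ... | refl = cong (m ,_) (xor-cancelʳ (flipped m) (cong proj₂ eq′))

    arrangementCycle : ProperCycle G (double q)
    arrangementCycle = record
      { cvert   = cycleVtx ∘ slot
      ; ccol    = cycleCol ∘ slot
      ; cinj    = λ i j i< j< eq → trans (sym (index-slot i))
                    (trans (cong index (cycleVtx-injective (slot i) (slot j) (slot-bound q i i<) (slot-bound q j j<) eq)) (index-slot j))
      ; cedges  = λ k k< → subst (λ i → edge G (cycleVtx (slot k)) (cycleVtx (slot (suc i % double (suc q)))) (cycleCol (slot k)) ≡ true)
                    (index-slot k) (cycle-edge (proj₁ (slot k)) (proj₂ (slot k)) (slot-bound q k k<))
      ; cproper = λ k k< → subst (λ i → cycleCol (slot k) ≢ cycleCol (slot (suc i % double (suc q))))
                    (index-slot k) (cycle-proper (proj₁ (slot k)) (proj₂ (slot k)) (slot-bound q k k<))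
      }

    arrangementCycle-spans : SameVertexSet arrangementCycle P
    arrangementCycle-spans v = mk⇔ to from
      where
      to : (∃ λ k → k < double (suc q) × cycleVtx (slot k) ≡ v) → (∃ λ j → j < 2 * suc q × vert P j ≡ v)
      to (k , k< , eq) = let (m , b) = slot k in
        index (order m , b xor flipped m) , index<length (b xor flipped m) (order-bound m (slot-bound q k k<)) , eq
      from : (∃ λ j → j < 2 * suc q × vert P j ≡ v) → (∃ λ k → k < double (suc q) × cycleVtx (slot k) ≡ v)
      from (j , j< , eq) = index s , index-bound (proj₂ s) (order⁻¹-bound m m≤q) , hits
        where
        m = proj₁ (slot j)
        b = proj₂ (slot j)
        m≤q = slot-bound q j (subst (j <_) (sym (double≡2* (suc q))) j<)
        s = order⁻¹ m , b xor flipped (order⁻¹ m)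
        hits : cycleVtx (slot (index s)) ≡ v
        hits = begin
          cycleVtx (slot (index s))                               ≡⟨ cong cycleVtx (slot-index s) ⟩
          vtx (order (order⁻¹ m) , (b xor f) xor f)               ≡⟨ cong₂ (λ k o → vtx (k , o)) (order-order⁻¹ m m≤q) (xor-involutiveʳ f b) ⟩
          vert P (index (slot j))                                 ≡⟨ cong (vert P) (index-slot j) ⟩
          vert P j                                                ≡⟨ eq ⟩
          v                                                       ∎
          where
          open ≡-Reasoning
          f = flipped (order⁻¹ m)

    arrangement-hamiltonian : HamiltonianCycle
    arrangement-hamiltonian = double q , arrangementCycle , arrangementCycle-spans

  module Cycles (a : Fin c) (a≢red : a ≢ red) where

    closing : edge G (y q) (x 0) a ≡ true → Arrangement
    closing yqx0 = record
      { order = λ m → m ; order⁻¹ = λ m → m ; flipped = λ _ → false ; joinColour = joinColour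
      ; order-bound = λ _ m≤q → m≤q ; order⁻¹-bound = λ _ m≤q → m≤q
      ; order⁻¹-order = λ _ _ → refl ; order-order⁻¹ = λ _ _ → refl
      ; joinColour≢red = joinColour≢red ; join = join ; close = close }
      where
      joinColour : ℕ → Fin c
      joinColour m = if m <ᵇ q then link m else a
      joinColour≢red : ∀ m → m ≤ q → joinColour m ≢ red
      joinColour≢red m m≤q with m≤n⇒m<n∨m≡n m≤q
      ... | inj₁ m<q  rewrite <⇒<ᵇ≡true m<q = link≢red m<q
      ... | inj₂ refl rewrite ≤⇒<ᵇ≡false (≤-refl {m}) = a≢red
      join : ∀ m → m < q → edge G (y m) (x (suc m)) (joinColour m) ≡ true
      join m m<q rewrite <⇒<ᵇ≡true m<q = link-edge m<q
      close : edge G (y q) (x 0) (joinColour q) ≡ true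
      close rewrite ≤⇒<ᵇ≡false (≤-refl {q}) = yqx0

    -- x_0 … y_j, then y_q x_q y_{q-1} … x_{j+1} backwards, then back to x_0.
    module Reversal (j : ℕ) (j<q : j < q)
                    (yjyq : edge G (y j) (y q) a ≡ true) (x0xj+1 : edge G (x 0) (x (suc j)) a ≡ true) where

      rev : ℕ → ℕ
      rev m = q + suc j ∸ m

      rev-bound : ∀ m → suc j ≤ m → rev m ≤ q
      rev-bound m j<m = subst (rev m ≤_) (m+n∸n≡m q (suc j)) (∸-monoʳ-≤ (q + suc j) j<m)

      rev-lower : ∀ m → m ≤ q → suc j ≤ rev m
      rev-lower m m≤q = subst (_≤ rev m) (m+n∸m≡n q (suc j)) (∸-monoʳ-≤ (q + suc j) m≤q)

      rev-involutive : ∀ m → m ≤ q → rev (rev m) ≡ m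
      rev-involutive m m≤q = m∸[m∸n]≡n (≤-trans m≤q (m≤m+n q (suc j)))

      rev-suc : ∀ m → m < q → rev m ≡ suc (rev (suc m))
      rev-suc m m<q = m<n⇒n∸m≡1+[n∸1+m] (≤-trans m<q (m≤m+n q (suc j)))

      order : ℕ → ℕ
      order m = if m <ᵇ suc j then m else rev m

      flipped : ℕ → Bool
      flipped m = not (m <ᵇ suc j)

      joinColour : ℕ → Fin c
      joinColour m = if m <ᵇ j then link m else
                     if m <ᵇ suc j then a else
                     if m <ᵇ q then link (rev (suc m)) else a

      order-low : ∀ m → m ≤ j → order m ≡ m
      order-low m m≤j rewrite <⇒<ᵇ≡true (s≤s m≤j) = refl

      flipped-low : ∀ m → m ≤ j → flipped m ≡ false
      flipped-low m m≤j rewrite <⇒<ᵇ≡true (s≤s m≤j) = refl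

      order-high : ∀ m → j < m → order m ≡ rev m
      order-high m j<m rewrite ≤⇒<ᵇ≡false j<m = refl

      flipped-high : ∀ m → j < m → flipped m ≡ true
      flipped-high m j<m rewrite ≤⇒<ᵇ≡false j<m = refl

      order-bound : ∀ m → m ≤ q → order m ≤ q
      order-bound m m≤q with m ≤? j
      ... | yes m≤j rewrite order-low m m≤j = m≤q
      ... | no  m≰j rewrite order-high m (≰⇒> m≰j) = rev-bound m (≰⇒> m≰j)

      order-involutive : ∀ m → m ≤ q → order (order m) ≡ m
      order-involutive m m≤q with m ≤? j
      ... | yes m≤j rewrite order-low m m≤j = order-low m m≤j
      ... | no  m≰j rewrite order-high m (≰⇒> m≰j) =
        trans (order-high (rev m) (rev-lower m m≤q)) (rev-involutive m m≤q)

      joinColour≢red : ∀ m → m ≤ q → joinColour m ≢ red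
      joinColour≢red m m≤q with <-cmp m j
      ... | tri< m<j _ _ rewrite <⇒<ᵇ≡true m<j = link≢red (<-≤-trans m<j (<⇒≤ j<q))
      ... | tri≈ _ refl _ rewrite ≤⇒<ᵇ≡false (≤-refl {m}) | <⇒<ᵇ≡true (n<1+n m) = a≢red
      ... | tri> _ _ j<m with m <? q
      ...   | yes m<q rewrite ≤⇒<ᵇ≡false (<⇒≤ j<m) | ≤⇒<ᵇ≡false j<m | <⇒<ᵇ≡true m<q =
                link≢red (subst (_≤ q) (rev-suc m m<q) (rev-bound m j<m))
      ...   | no  m≮q rewrite ≤⇒<ᵇ≡false (<⇒≤ j<m) | ≤⇒<ᵇ≡false j<m | ≤⇒<ᵇ≡false (≮⇒≥ m≮q) = a≢red

      join : ∀ m → m < q →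
        edge G (vtx (order m , not (flipped m))) (vtx (order (suc m) , flipped (suc m))) (joinColour m) ≡ true
      join m m<q with <-cmp m j
      ... | tri< m<j _ _ rewrite order-low m (<⇒≤ m<j) | flipped-low m (<⇒≤ m<j)
                               | order-low (suc m) m<j | flipped-low (suc m) m<j | <⇒<ᵇ≡true m<j = link-edge m<q
      ... | tri≈ _ refl _ rewrite order-low m ≤-refl | flipped-low m ≤-refl
                                | order-high (suc m) (n<1+n m) | flipped-high (suc m) (n<1+n m)
                                | ≤⇒<ᵇ≡false (≤-refl {m}) | <⇒<ᵇ≡true (n<1+n m) | m+n∸n≡m q (suc m) = yjyq
      ... | tri> _ _ j<m rewrite order-high m j<m | flipped-high m j<m
                               | order-high (suc m) (m<n⇒m<1+n j<m) | flipped-high (suc m) (m<n⇒m<1+n j<m)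
                               | ≤⇒<ᵇ≡false (<⇒≤ j<m) | ≤⇒<ᵇ≡false j<m | <⇒<ᵇ≡true m<q | rev-suc m m<q =
        trans (MG.sym G _ _ _) (link-edge (subst (_≤ q) (rev-suc m m<q) (rev-bound m j<m)))

      close : edge G (vtx (order q , not (flipped q))) (vtx (order 0 , flipped 0)) (joinColour q) ≡ true
      close rewrite order-high q j<q | flipped-high q j<q | order-low 0 z≤n | flipped-low 0 z≤n
                  | ≤⇒<ᵇ≡false (<⇒≤ j<q) | ≤⇒<ᵇ≡false j<q | ≤⇒<ᵇ≡false (≤-refl {q}) | m+n∸m≡n q (suc j) =
        trans (MG.sym G _ _ _) x0xj+1

      reversal : Arrangement
      reversal = record
        { order = order ; order⁻¹ = order ; flipped = flipped ; joinColour = joinColour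
        ; order-bound = order-bound ; order⁻¹-bound = order-bound
        ; order⁻¹-order = order-involutive ; order-order⁻¹ = order-involutive
        ; joinColour≢red = joinColour≢red ; join = join ; close = close }

    -- x_0 … y_h, then x_{h+2} … y_q, then x_{h+1} y_{h+1}, then back to x_0.
    module Shift (h : ℕ) (h+2≤q : suc (suc h) ≤ q)
                 (yhxh+2 : edge G (y h) (x (suc (suc h))) a ≡ true)
                 (yqxh+1 : edge G (y q) (x (suc h)) a ≡ true)
                 (yh+1x0 : edge G (y (suc h)) (x 0) a ≡ true) where

      h<q : h < q
      h<q = ≤-trans (n≤1+n _) h+2≤q

      order : ℕ → ℕ
      order m = if m <ᵇ suc h then m else if m <ᵇ q then suc m else suc h

      order⁻¹ : ℕ → ℕ
      order⁻¹ k = if k <ᵇ suc h then k else if k <ᵇ suc (suc h) then q else pred k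

      joinColour : ℕ → Fin c
      joinColour m = if m <ᵇ h then link m else
                     if m <ᵇ suc h then a else
                     if suc m <ᵇ q then link (suc m) else a

      order-low : ∀ m → m ≤ h → order m ≡ m
      order-low m m≤h rewrite <⇒<ᵇ≡true (s≤s m≤h) = refl

      order-mid : ∀ m → h < m → m < q → order m ≡ suc m
      order-mid m h<m m<q rewrite ≤⇒<ᵇ≡false h<m | <⇒<ᵇ≡true m<q = refl

      order-top : order q ≡ suc h
      order-top rewrite ≤⇒<ᵇ≡false h<q | ≤⇒<ᵇ≡false (≤-refl {q}) = refl

      order⁻¹-low : ∀ k → k ≤ h → order⁻¹ k ≡ k
      order⁻¹-low k k≤h rewrite <⇒<ᵇ≡true (s≤s k≤h) = refl

      order⁻¹-mid : order⁻¹ (suc h) ≡ q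
      order⁻¹-mid rewrite ≤⇒<ᵇ≡false (≤-refl {suc h}) | <⇒<ᵇ≡true (n<1+n (suc h)) = refl

      order⁻¹-high : ∀ k → suc (suc h) ≤ k → order⁻¹ k ≡ pred k
      order⁻¹-high k h+2≤k rewrite ≤⇒<ᵇ≡false (≤-trans (n≤1+n (suc h)) h+2≤k) | ≤⇒<ᵇ≡false h+2≤k = refl

      order-bound : ∀ m → m ≤ q → order m ≤ q
      order-bound m m≤q with m ≤? h | m≤n⇒m<n∨m≡n m≤q
      ... | yes m≤h | _         rewrite order-low m m≤h = m≤q
      ... | no  m≰h | inj₁ m<q  rewrite order-mid m (≰⇒> m≰h) m<q = m<q
      ... | no  m≰h | inj₂ refl rewrite order-top = h<q

      order⁻¹-bound : ∀ k → k ≤ q → order⁻¹ k ≤ q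
      order⁻¹-bound k k≤q with k ≤? h | k ≟ suc h
      ... | yes k≤h | _        rewrite order⁻¹-low k k≤h = k≤q
      ... | no  _   | yes refl rewrite order⁻¹-mid = ≤-refl
      ... | no  k≰h | no  k≢   rewrite order⁻¹-high k (≤∧≢⇒< (≰⇒> k≰h) (k≢ ∘ sym)) = ≤-trans pred[n]≤n k≤q

      order⁻¹-order : ∀ m → m ≤ q → order⁻¹ (order m) ≡ m
      order⁻¹-order m m≤q with m ≤? h | m≤n⇒m<n∨m≡n m≤q
      ... | yes m≤h | _         rewrite order-low m m≤h = order⁻¹-low m m≤h
      ... | no  m≰h | inj₁ m<q  rewrite order-mid m (≰⇒> m≰h) m<q = order⁻¹-high (suc m) (s≤s (≰⇒> m≰h))
      ... | no  m≰h | inj₂ refl rewrite order-top = order⁻¹-mid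

      order-order⁻¹ : ∀ k → k ≤ q → order (order⁻¹ k) ≡ k
      order-order⁻¹ k k≤q with k ≤? h | k ≟ suc h
      ... | yes k≤h | _        rewrite order⁻¹-low k k≤h = order-low k k≤h
      ... | no  _   | yes refl rewrite order⁻¹-mid = order-top
      ... | no  k≰h | no  k≢   = shift-back k (≤∧≢⇒< (≰⇒> k≰h) (k≢ ∘ sym)) k≤q
        where
        shift-back : ∀ k → suc (suc h) ≤ k → k ≤ q → order (order⁻¹ k) ≡ k
        shift-back (suc k) (s≤s h<k) k<q rewrite order⁻¹-high (suc k) (s≤s h<k) | order-mid k h<k k<q = refl

      joinColour≢red : ∀ m → m ≤ q → joinColour m ≢ red
      joinColour≢red m m≤q with <-cmp m h
      ... | tri< m<h _ _ rewrite <⇒<ᵇ≡true m<h = link≢red (<-trans m<h h<q)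
      ... | tri≈ _ refl _ rewrite ≤⇒<ᵇ≡false (≤-refl {m}) | <⇒<ᵇ≡true (n<1+n m) = a≢red
      ... | tri> _ _ h<m with suc m <? q
      ...   | yes m+1<q rewrite ≤⇒<ᵇ≡false (<⇒≤ h<m) | ≤⇒<ᵇ≡false h<m | <⇒<ᵇ≡true m+1<q = link≢red m+1<q
      ...   | no  m+1≮q rewrite ≤⇒<ᵇ≡false (<⇒≤ h<m) | ≤⇒<ᵇ≡false h<m | ≤⇒<ᵇ≡false (≮⇒≥ m+1≮q) = a≢red

      join : ∀ m → m < q → edge G (y (order m)) (x (order (suc m))) (joinColour m) ≡ true
      join m m<q with <-cmp m h
      ... | tri< m<h _ _ rewrite order-low m (<⇒≤ m<h) | order-low (suc m) m<h | <⇒<ᵇ≡true m<h = link-edge m<q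
      ... | tri≈ _ refl _ rewrite order-low m ≤-refl | order-mid (suc m) (n<1+n m) h+2≤q
                                | ≤⇒<ᵇ≡false (≤-refl {m}) | <⇒<ᵇ≡true (n<1+n m) = yhxh+2
      ... | tri> _ _ h<m with m≤n⇒m<n∨m≡n m<q
      ...   | inj₁ m+1<q rewrite order-mid m h<m m<q | order-mid (suc m) (m<n⇒m<1+n h<m) m+1<q
                               | ≤⇒<ᵇ≡false (<⇒≤ h<m) | ≤⇒<ᵇ≡false h<m | <⇒<ᵇ≡true m+1<q = link-edge m+1<q
      ...   | inj₂ refl rewrite order-mid m h<m m<q | order-top
                              | ≤⇒<ᵇ≡false (<⇒≤ h<m) | ≤⇒<ᵇ≡false h<m | ≤⇒<ᵇ≡false (≤-refl {suc m}) = yqxh+1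

      close : edge G (y (order q)) (x (order 0)) (joinColour q) ≡ true
      close rewrite order-top | order-low 0 z≤n | ≤⇒<ᵇ≡false (<⇒≤ h<q) | ≤⇒<ᵇ≡false h<q | ≤⇒<ᵇ≡false (n≤1+n q) = yh+1x0

      shift : Arrangement
      shift = record
        { order = order ; order⁻¹ = order⁻¹ ; flipped = λ _ → false ; joinColour = joinColour
        ; order-bound = order-bound ; order⁻¹-bound = order⁻¹-bound
        ; order⁻¹-order = order⁻¹-order ; order-order⁻¹ = order-order⁻¹
        ; joinColour≢red = joinColour≢red ; join = join ; close = close }

  -- Gadgets

  data Gadget : Set where
    closingGadget  : Gadget
    reversalGadget : ℕ → Gadget
    shiftGadget    : ℕ → Gadget

  Valid : Gadget → Set
  Valid closingGadget      = ⊤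
  Valid (reversalGadget j) = j < q
  Valid (shiftGadget h)    = suc (suc h) ≤ q

  data _∋_—_ : Gadget → Slot → Slot → Set where
    closing-yqx0   : closingGadget ∋ (q , true) — (0 , false)
    reversal-yjyq  : ∀ {j} → reversalGadget j ∋ (j , true) — (q , true)
    reversal-x0xj  : ∀ {j} → reversalGadget j ∋ (0 , false) — (suc j , false)
    shift-yhxh+2   : ∀ {h} → shiftGadget h ∋ (h , true) — (suc (suc h) , false)
    shift-yqxh+1   : ∀ {h} → shiftGadget h ∋ (q , true) — (suc h , false)
    shift-yh+1x0   : ∀ {h} → shiftGadget h ∋ (suc h , true) — (0 , false)

  gadgets-disjoint : ∀ {f f′ u v} → Valid f → Valid f′ → f ∋ u — v → (f′ ∋ u — v ⊎ f′ ∋ v — u) → f ≡ f′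
  gadgets-disjoint _ _ closing-yqx0 (inj₁ closing-yqx0) = refl
  gadgets-disjoint _ h+2≤q closing-yqx0 (inj₁ shift-yh+1x0) = ⊥-elim (<-irrefl refl h+2≤q)
  gadgets-disjoint _ _ reversal-yjyq (inj₁ reversal-yjyq) = refl
  gadgets-disjoint j<q _ reversal-yjyq (inj₂ reversal-yjyq) = ⊥-elim (<-irrefl refl j<q)
  gadgets-disjoint _ _ reversal-x0xj (inj₁ reversal-x0xj) = refl
  gadgets-disjoint _ _ shift-yhxh+2 (inj₁ shift-yhxh+2) = refl
  gadgets-disjoint _ h+2≤q shift-yhxh+2 (inj₁ shift-yqxh+1) = ⊥-elim (<-irrefl refl (≤-trans (m≤n+m _ 2) h+2≤q))
  gadgets-disjoint h+2≤q _ shift-yqxh+1 (inj₁ shift-yhxh+2) = ⊥-elim (<-irrefl refl (≤-trans (m≤n+m _ 2) h+2≤q))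
  gadgets-disjoint _ _ shift-yqxh+1 (inj₁ shift-yqxh+1) = refl
  gadgets-disjoint h+2≤q _ shift-yh+1x0 (inj₁ closing-yqx0) = ⊥-elim (<-irrefl refl h+2≤q)
  gadgets-disjoint _ _ shift-yh+1x0 (inj₁ shift-yh+1x0) = refl

  gadget-pair-bound : ∀ {f u v} → Valid f → f ∋ u — v → proj₁ u ≤ q × proj₁ v ≤ q
  gadget-pair-bound _     closing-yqx0  = ≤-refl , z≤n
  gadget-pair-bound j<q   reversal-yjyq = <⇒≤ j<q , ≤-refl
  gadget-pair-bound j<q   reversal-x0xj = z≤n , j<q
  gadget-pair-bound h+2≤q shift-yhxh+2  = ≤-trans (m≤n+m _ 2) h+2≤q , h+2≤q
  gadget-pair-bound h+2≤q shift-yqxh+1  = ≤-refl , ≤-trans (n≤1+n _) h+2≤q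
  gadget-pair-bound h+2≤q shift-yh+1x0  = ≤-trans (n≤1+n _) h+2≤q , z≤n

  gadget-pair-distinct : ∀ {f u v} → Valid f → f ∋ u — v → u ≢ v
  gadget-pair-distinct j<q reversal-yjyq refl = <-irrefl refl j<q

  record MissingPair (a : Fin c) (f : Gadget) : Set where
    field
      {u v}   : Slot
      pair    : f ∋ u — v
      absent  : edge G (vtx u) (vtx v) a ≡ false

  missingPair : ¬ HamiltonianCycle → ∀ a → a ≢ red → ∀ f → Valid f → MissingPair a f
  missingPair no-cycle a a≢red closingGadget _
    with edge G (y q) (x 0) a in yqx0
  ... | true  = ⊥-elim (no-cycle (arrangement-hamiltonian (closing yqx0)))
    where open Cycles a a≢red
  ... | false = record { pair = closing-yqx0 ; absent = yqx0 }
  missingPair no-cycle a a≢red (reversalGadget j) j<q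
    with edge G (y j) (y q) a in yjyq | edge G (x 0) (x (suc j)) a in x0xj+1
  ... | true  | true  = ⊥-elim (no-cycle (arrangement-hamiltonian (Reversal.reversal j j<q yjyq x0xj+1)))
    where open Cycles a a≢red
  ... | false | _     = record { pair = reversal-yjyq ; absent = yjyq }
  ... | true  | false = record { pair = reversal-x0xj ; absent = x0xj+1 }
  missingPair no-cycle a a≢red (shiftGadget h) h+2≤q
    with edge G (y h) (x (suc (suc h))) a in yhxh+2 | edge G (y q) (x (suc h)) a in yqxh+1
       | edge G (y (suc h)) (x 0) a in yh+1x0
  ... | true  | true  | true  = ⊥-elim (no-cycle (arrangement-hamiltonian (Shift.shift h h+2≤q yhxh+2 yqxh+1 yh+1x0)))
    where open Cycles a a≢red
  ... | false | _     | _     = record { pair = shift-yhxh+2 ; absent = yhxh+2 }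
  ... | true  | false | _     = record { pair = shift-yqxh+1 ; absent = yqxh+1 }
  ... | true  | true  | false = record { pair = shift-yh+1x0 ; absent = yh+1x0 }

  same-pair⇒same-gadget : ∀ {f f′ u v u′ v′} → Valid f → Valid f′ → f ∋ u — v → f′ ∋ u′ — v′ →
    (vtx u ≡ vtx u′ × vtx v ≡ vtx v′) ⊎ (vtx u ≡ vtx v′ × vtx v ≡ vtx u′) → f ≡ f′
  same-pair⇒same-gadget {u = u} {v} {u′} {v′} valid valid′ uv u′v′ (inj₁ (u≡u′ , v≡v′))
    with vtx-injective u u′ (proj₁ (gadget-pair-bound valid uv)) (proj₁ (gadget-pair-bound valid′ u′v′)) u≡u′
       | vtx-injective v v′ (proj₂ (gadget-pair-bound valid uv)) (proj₂ (gadget-pair-bound valid′ u′v′)) v≡v′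
  ... | refl | refl = gadgets-disjoint valid valid′ uv (inj₁ u′v′)
  same-pair⇒same-gadget {u = u} {v} {u′} {v′} valid valid′ uv u′v′ (inj₂ (u≡v′ , v≡u′))
    with vtx-injective u v′ (proj₁ (gadget-pair-bound valid uv)) (proj₂ (gadget-pair-bound valid′ u′v′)) u≡v′
       | vtx-injective v u′ (proj₂ (gadget-pair-bound valid uv)) (proj₁ (gadget-pair-bound valid′ u′v′)) v≡u′
  ... | refl | refl = gadgets-disjoint valid valid′ uv (inj₂ u′v′)

  gadget : ℕ → Gadget
  gadget zero    = closingGadget
  gadget (suc t) = if t <ᵇ q then reversalGadget t else shiftGadget (t ∸ q)

  gadgetIndex : Gadget → ℕ
  gadgetIndex closingGadget      = 0
  gadgetIndex (reversalGadget j) = suc j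
  gadgetIndex (shiftGadget h)    = suc (q + h)

  gadgetIndex-gadget : ∀ t → gadgetIndex (gadget t) ≡ t
  gadgetIndex-gadget zero = refl
  gadgetIndex-gadget (suc t) with t <? q
  ... | yes t<q rewrite <⇒<ᵇ≡true t<q = refl
  ... | no  t≮q rewrite ≤⇒<ᵇ≡false (≮⇒≥ t≮q) = cong suc (m+[n∸m]≡n (≮⇒≥ t≮q))

  gadget-injective : ∀ {t t′} → gadget t ≡ gadget t′ → t ≡ t′
  gadget-injective {t} {t′} eq =
    trans (sym (gadgetIndex-gadget t)) (trans (cong gadgetIndex eq) (gadgetIndex-gadget t′))

  gadget-valid : ∀ t → t < double q → Valid (gadget t)
  gadget-valid zero    _ = tt
  gadget-valid (suc t) t+1<2q with t <? q
  ... | yes t<q rewrite <⇒<ᵇ≡true t<q = t<q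
  ... | no  t≮q rewrite ≤⇒<ᵇ≡false (≮⇒≥ t≮q) = +-cancelʳ-≤ q _ _
    (subst₂ _≤_ (cong (2 +_) (sym (m∸n+n≡m (≮⇒≥ t≮q)))) (double≡m+m q) t+1<2q)


module _ {n c′ : ℕ} (G : MG n (suc c′)) (red : Fin (suc c′)) (q : ℕ) (P : ProperPath G (2 * suc q))
         (red-cols : ∀ i → i < suc q → col P (2 * i) ≡ red) where
  open AlternatingPath G red q P red-cols

  -- The missing edges are indexed by a non-red colour and a gadget number.
  no-hamiltonian⇒missing : ¬ HamiltonianCycle → c′ * double q ≤ missing G
  no-hamiltonian⇒missing no-cycle = missing-lower-bound G missingEdge missingEdge-absent missingEdge-distinct
    where
    decompose : Fin (c′ * double q) → Fin c′ × Fin (double q)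
    decompose = remQuot (double q)

    colour : Fin (c′ * double q) → Fin (suc c′)
    colour k = punchIn red (proj₁ (decompose k))

    gadgetNo : Fin (c′ * double q) → ℕ
    gadgetNo k = toℕ (proj₂ (decompose k))

    valid : ∀ k → Valid (gadget (gadgetNo k))
    valid k = gadget-valid (gadgetNo k) (toℕ<n (proj₂ (decompose k)))

    pick : ∀ k → MissingPair (colour k) (gadget (gadgetNo k))
    pick k = missingPair no-cycle (colour k) (punchInᵢ≢i red _) (gadget (gadgetNo k)) (valid k)

    missingEdge : Fin (c′ * double q) → Fin n × Fin n × Fin (suc c′)
    missingEdge k = vtx (MissingPair.u (pick k)) , vtx (MissingPair.v (pick k)) , colour k

    missingEdge-absent : ∀ k → let (u , v , a) = missingEdge k in u ≢ v × edge G u v a ≡ false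
    missingEdge-absent k = gadget-pair-distinct (valid k) (MissingPair.pair (pick k))
                             ∘ vtx-injective _ _ (proj₁ bounds) (proj₂ bounds)
                         , MissingPair.absent (pick k)
      where bounds = gadget-pair-bound (valid k) (MissingPair.pair (pick k))

    missingEdge-distinct : ∀ k l → SameEdge (missingEdge k) (missingEdge l) → k ≡ l
    missingEdge-distinct k l (same-colour , same-pair) = begin
      k                                ≡⟨ combine-remQuot {c′} (double q) k ⟨
      uncurry combine (decompose k)    ≡⟨ cong (uncurry combine) (cong₂ _,_ same-a same-t) ⟩
      uncurry combine (decompose l)    ≡⟨ combine-remQuot {c′} (double q) l ⟩
      l                                ∎
      where
      open ≡-Reasoning
      same-a = punchIn-injective red _ _ same-colour
      same-t = toℕ-injective (gadget-injective (same-pair⇒same-gadget (valid k) (valid l)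
                 (MissingPair.pair (pick k)) (MissingPair.pair (pick l)) same-pair))

lemma2p4 : ∀ {n c : ℕ} (G : MG n c) (red : Fin c) → 2 ≤ c → Connected G →
    (p : ℕ) → 3 ≤ p → (P : ProperPath G (2 * p)) →
    (∀ i → i < p → col P (2 * i) ≡ red) →
    ¬ (∃ λ l → ∃ λ (C : ProperCycle G l) → SameVertexSet C P) →
    (c ∸ 1) * (2 * p ∸ 2) ≤ missing G
lemma2p4 {c = suc c′} G red (s≤s _) _ (suc q) (s≤s _) P red-cols no-cycle =
  subst (λ k → c′ * (k ∸ 2) ≤ missing G) (double≡2* (suc q))
    (no-hamiltonian⇒missing G red q P red-cols no-cycle)
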